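{- Let $\Upsilon=(\Gamma,\sigma,\varphi)$ be a gain signed graph with orientation $\tau$, let $\zeta:V\to\{\pm1\}$ be a sign switcher and $\theta:V\to\mathbb{K}$ a gain switcher. For every edge set $S\subseteq E$, $S$ is hyperbalanced in $\Upsilon$ if and only if it is hyperbalanced in the sign-switched graph $\Upsilon^\zeta$, and if and only if it is hyperbalanced in the gain-switched graph $(\Gamma,\sigma,\varphi^\theta)$.
   Context: Let $\mathbb{K}$ be a field of characteristic $\ne2$. A graph $\Gamma=(V,E)$ has vertex set $V=\{v_1,\dots,v_n\}$ and finite edge set $E$; edges are links (two ends at distinct vertices), loops (two ends at one vertex), half edges (one end) or loose edges (no ends); parallel edges allowed. A gain signed graph $\Upsilon=(\Gamma,\sigma,\varphi)$: $\sigma:E\to\{\pm1\}$ (half edges negative, loose edges positive); with an orientation $\tau$ (signs $\tau(v,e)\in\{\pm1\}$ on edge ends, $\tau(v,e)\tau(w,e)=-\sigma(e)$ for a link or loop with ends $v,w$) each edge has gain $\varphi(e)\in\mathbb{K}$, negated on reorientation. Neutral = gain $0$. Walk gain of $W=u_0e_1\cdots e_lu_l$: $\varphi(W)=-\sum_i\varphi(e_i)\sigma(W_{0,i-1})\tau(u_{i-1},e_i)$, $\sigma(W_{0,j})=\prod_{i\le j}\sigma(e_i)$. Ultrawalks may begin with a half edge $e_0$ at $u_0$ and/or end with a half edge $e_{l+1}$ at $u_l$; their gain adds $\tau(u_0,e_0)\varphi(e_0)$ and/or $-\varphi(e_{l+1})\sigma(W_{0,l})\tau(u_l,e_{l+1})$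 to $\varphi(W_{0,l})$. Circles: connected 2-regular subgraphs, sign = product of edge signs; a negative figure is a negative circle or a half edge. A sign circuit is a positive circle, a loose edge, or a handcuff (two negative figures with exactly one common vertex, or two disjoint negative figures plus a path joining them meeting them only at its ends). Its gain: the edge gain for a loose edge; else $\varphi(W)$ for a circuit walk (once around a positive circle; for a handcuff with figures $C_1,C_2$, connecting path $P$ of length $\ge0$: around $C_1$, along $P$, around $C_2$, back along $P$ if both circles; from half edge $C_1$ along $P$, around $C_2$, back, ending with $C_1$ if $C_1$ half edge and $C_2$ circle; from one half edge along $P$ to the other if both half edges); well defined up to sign; neutral if $0$. $S$ is hyperbalanced if all sign circuits contained in $S$ are neutral. Sign switching by $\zeta$: $\Upsilon^\zeta$ has $\sigma^\zeta(e)=\zeta(v)\sigma(e)\zeta(w)$ for a link or loop with ends $v,w$ (half and loose edges keep their signs), orientation $\tau^\zeta(v,e)=\zeta(v)\tau(v,e)$, and unchanged gains. Gain switching by $\theta$: $\varphi^\theta(e)=\tau(v,e)\theta(v)+\varphi(e)+\tau(w,e)\theta(w)$ for a link or loop with ends $v,w$, $\varphi^\theta(e)=\tau(v,e)\theta(v)+\varphi(e)$ for a half edge at $v$, $\varphi^\theta(e)=\varphi(e)$ for a loose edge. -}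

module Defs where

open import Level using (Level; _⊔_) renaming (suc to lsuc)
open import Algebra.Bundles using (CommutativeRing)
open import Data.Nat using (ℕ; zero; suc; _≤_)
open import Data.Fin using (Fin)
open import Data.Fin.Subset using (Subset) renaming (_∈_ to _∈ₛ_)
open import Data.Sign using (Sign; opposite) renaming (_*_ to _·ₛ_; + to ⊕; - to ⊖)
open import Data.List using (List; []; _∷_; _++_; length)
open import Data.List.Membership.Propositional using (_∈_)
open import Data.List.Relation.Unary.Unique.Propositional using (Unique)
open import Data.Product using (Σ; _×_; ∃)
open import Relation.Nullary using (¬_)
open import Relation.Binary.PropositionalEquality using (_≡_)

record Field (c ℓ : Level) : Set (lsuc (c ⊔ ℓ)) where
  field
    commutativeRing : CommutativeRing c ℓ
  open CommutativeRing commutativeRing public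
  field
    0≉1     : ¬ (0# ≈ 1#)
    inverse : ∀ x → ¬ (x ≈ 0#) → Σ Carrier λ y → x * y ≈ 1#

CharNot2 : ∀ {c ℓ} → Field c ℓ → Set ℓ
CharNot2 K = ¬ (1# + 1# ≈ 0#) where open Field K

-- Graphs: vertices Fin n, edges Fin m; each edge has its ends.
--   two v w : an edge with end ₁ at v and end ₂ at w
--             (a link if v ≢ w, a loop if v ≡ w)
--   half v  : a half edge with its (single) end ₁ at v
--   loose   : a loose edge (no ends)

data Ends (n : ℕ) : Set where
  two   : Fin n → Fin n → Ends n
  half  : Fin n → Ends n
  loose : Ends n

data End : Set where
  ₁ ₂ : End

Graph : ℕ → ℕ → Set
Graph n m = Fin m → Ends n

data Step {n m : ℕ} (Γ : Graph n m) : Fin n → Fin n → Set where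
  fwd : ∀ {u v} (e : Fin m) → Γ e ≡ two u v → Step Γ u v
  bwd : ∀ {u v} (e : Fin m) → Γ e ≡ two v u → Step Γ u v

data Walk {n m : ℕ} (Γ : Graph n m) : Fin n → Fin n → Set where
  []  : ∀ {u} → Walk Γ u u
  _∷_ : ∀ {u v w} → Step Γ u v → Walk Γ v w → Walk Γ u w

infixr 5 _∷_

module _ {n m : ℕ} {Γ : Graph n m} where

  stepEdge : ∀ {u v} → Step Γ u v → Fin m
  stepEdge (fwd e _) = e
  stepEdge (bwd e _) = e

  stepEnd : ∀ {u v} → Step Γ u v → End
  stepEnd (fwd _ _) = ₁
  stepEnd (bwd _ _) = ₂

  revStep : ∀ {u v} → Step Γ u v → Step Γ v u
  revStep (fwd e p) = bwd e p
  revStep (bwd e p) = fwd e p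

  _++W_ : ∀ {u v w} → Walk Γ u v → Walk Γ v w → Walk Γ u w
  []      ++W W' = W'
  (s ∷ W) ++W W' = s ∷ (W ++W W')

  infixr 5 _++W_

  revW : ∀ {u v} → Walk Γ u v → Walk Γ v u
  revW []      = []
  revW (s ∷ W) = revW W ++W (revStep s ∷ [])

  lengthW : ∀ {u v} → Walk Γ u v → ℕ
  lengthW []      = 0
  lengthW (_ ∷ W) = suc (lengthW W)

  edgesW : ∀ {u v} → Walk Γ u v → List (Fin m)
  edgesW []      = []
  edgesW (s ∷ W) = stepEdge s ∷ edgesW W

  vertsW : ∀ {u v} → Walk Γ u v → List (Fin n)
  vertsW {u} []      = u ∷ []
  vertsW {u} (_ ∷ W) = u ∷ vertsW W

  departW : ∀ {u v} → Walk Γ u v → List (Fin n)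
  departW []          = []
  departW {u} (_ ∷ W) = u ∷ departW W

  IsCircleWalk : ∀ {u} → Walk Γ u u → Set
  IsCircleWalk C = (1 ≤ lengthW C) × Unique (edgesW C) × Unique (departW C)

  IsPath : ∀ {u v} → Walk Γ u v → Set
  IsPath P = Unique (vertsW P)

-- Gain signed graphs over a field K (with orientation τ).
-- τ e i is the orientation sign at end i of edge e; only the ends that
-- exist (both ends of a `two` edge, end ₁ of a half edge) are ever used.

record GSG {c ℓ : Level} (K : Field c ℓ) (n m : ℕ) : Set c where
  field
    Γ : Graph n m
    σ : Fin m → Sign
    τ : Fin m → End → Sign
    φ : Fin m → Field.Carrier K

module _ {c ℓ : Level} (K : Field c ℓ) where
  open Field K

  _⊙_ : Sign → Carrier → Carrier
  ⊕ ⊙ x = x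
  ⊖ ⊙ x = - x

  module _ {n m : ℕ} (Υ : GSG K n m) where
    open GSG Υ

    WellFormedEdge : Ends n → Fin m → Set
    WellFormedEdge (two _ _) e = τ e ₁ ·ₛ τ e ₂ ≡ opposite (σ e)
    WellFormedEdge (half _)  e = σ e ≡ ⊖
    WellFormedEdge loose     e = σ e ≡ ⊕

    IsGSG : Set
    IsGSG = ∀ e → WellFormedEdge (Γ e) e

    signW : ∀ {u v} → Walk Γ u v → Sign
    signW []      = ⊕
    signW (s ∷ W) = σ (stepEdge s) ·ₛ signW W

    -- Σ_i φ(e_i) σ(prefix) τ(u_{i-1},e_i), prefix sign starting at s
    gainAcc : Sign → ∀ {u v} → Walk Γ u v → Carrier
    gainAcc s []      = 0#
    gainAcc s (t ∷ W) =
      ((s ·ₛ τ (stepEdge t) (stepEnd t)) ⊙ φ (stepEdge t))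
        + gainAcc (s ·ₛ σ (stepEdge t)) W

    gainW : ∀ {u v} → Walk Γ u v → Carrier
    gainW W = - gainAcc ⊕ W

    startHalf : Fin m → Carrier
    startHalf h = τ h ₁ ⊙ φ h

    endHalf : ∀ {u v} → Walk Γ u v → Fin m → Carrier
    endHalf W h = - ((signW W ·ₛ τ h ₁) ⊙ φ h)

    data NegFig (u : Fin n) : Set where
      circ  : (C : Walk Γ u u) → IsCircleWalk C → signW C ≡ ⊖ → NegFig u
      hedge : (h : Fin m) → Γ h ≡ half u → NegFig u

    figVerts : ∀ {u} → NegFig u → List (Fin n)
    figVerts (circ C _ _)      = departW C
    figVerts {u} (hedge _ _)   = u ∷ []

    figEdges : ∀ {u} → NegFig u → List (Fin m)
    figEdges (circ C _ _)  = edgesW C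
    figEdges (hedge h _)   = h ∷ []

    IsHandcuff : ∀ {u w} → NegFig u → NegFig w → Walk Γ u w → Set
    IsHandcuff {u} {w} F₁ F₂ P =
      IsPath P
      × (∀ e → e ∈ figEdges F₁ → ¬ (e ∈ figEdges F₂))
      × (∀ x → x ∈ figVerts F₁ → x ∈ figVerts F₂ → (lengthW P ≡ 0) × (x ≡ u))
      × (∀ x → x ∈ vertsW P → x ∈ figVerts F₁ → x ≡ u)
      × (∀ x → x ∈ vertsW P → x ∈ figVerts F₂ → x ≡ w)

    -- sign circuits, each given together with a circuit walk
    data SignCircuit : Set where
      poscirc  : ∀ {u} (C : Walk Γ u u) → IsCircleWalk C → signW C ≡ ⊕
               → SignCircuit
      looseE   : (e : Fin m) → Γ e ≡ loose → SignCircuit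
      handcuff : ∀ {u w} (F₁ : NegFig u) (F₂ : NegFig w) (P : Walk Γ u w)
               → IsHandcuff F₁ F₂ P → SignCircuit

    circuitEdges : SignCircuit → List (Fin m)
    circuitEdges (poscirc C _ _)         = edgesW C
    circuitEdges (looseE e _)            = e ∷ []
    circuitEdges (handcuff F₁ F₂ P _)    = figEdges F₁ ++ edgesW P ++ figEdges F₂

    handcuffGain : ∀ {u w} → NegFig u → NegFig w → Walk Γ u w → Carrier
    handcuffGain (circ C₁ _ _) (circ C₂ _ _) P =
      gainW (C₁ ++W P ++W C₂ ++W revW P)
    handcuffGain (hedge h₁ _) (circ C₂ _ _) P =
      startHalf h₁ + gainW W + endHalf W h₁
      where W = P ++W C₂ ++W revW P
    handcuffGain (circ C₁ _ _) (hedge h₂ _) P =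
      startHalf h₂ + gainW W + endHalf W h₂
      where W = revW P ++W C₁ ++W P
    handcuffGain (hedge h₁ _) (hedge h₂ _) P =
      startHalf h₁ + gainW P + endHalf P h₂

    circuitGain : SignCircuit → Carrier
    circuitGain (poscirc C _ _)       = gainW C
    circuitGain (looseE e _)          = φ e
    circuitGain (handcuff F₁ F₂ P _)  = handcuffGain F₁ F₂ P

    Hyperbalanced : Subset m → Set ℓ
    Hyperbalanced S =
      (C : SignCircuit) → (∀ e → e ∈ circuitEdges C → e ∈ₛ S) → circuitGain C ≈ 0#

  module _ {n m : ℕ} where

    signSwitch : GSG K n m → (Fin n → Sign) → GSG K n m
    signSwitch Υ ζ = record { Γ = Γ ; σ = σζ ; τ = τζ ; φ = φ }
      where
        open GSG Υ
        σζ : Fin m → Sign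
        σζ e with Γ e
        ... | two v w = ζ v ·ₛ σ e ·ₛ ζ w
        ... | half _  = σ e
        ... | loose   = σ e
        τζ : Fin m → End → Sign
        τζ e i with Γ e | i
        ... | two v _ | ₁ = ζ v ·ₛ τ e ₁
        ... | two _ w | ₂ = ζ w ·ₛ τ e ₂
        ... | half v  | ₁ = ζ v ·ₛ τ e ₁
        ... | half _  | ₂ = τ e ₂
        ... | loose   | j = τ e j

    gainSwitch : GSG K n m → (Fin n → Carrier) → GSG K n m
    gainSwitch Υ θ = record { Γ = Γ ; σ = σ ; τ = τ ; φ = φθ }
      where
        open GSG Υ
        φθ : Fin m → Carrier
        φθ e with Γ e
        ... | two v w = ((τ e ₁ ⊙ θ v) + φ e) + (τ e ₂ ⊙ θ w)
        ... | half v  = (τ e ₁ ⊙ θ v) + φ e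
        ... | loose   = φ e

-- Both switchings leave the sign of every closed walk unchanged, so the sign circuits of Υ and of
-- the switched graph are the same edge sets, and only the neutrality of their gains is at stake.
-- Sign switching multiplies the gain of a walk starting at u by ζ(u). Gain switching adds
-- -θ(u) + σ(W)θ(v) to the gain of a walk W from u to v: this cancels on positive closed walks, and on
-- an ultrawalk between two half edges the two θ-terms are absorbed by the switched half-edge gains.

module Submission where

open import Defs
open import Level using (Level)
open import Data.Nat using (ℕ)
open import Data.Fin using (Fin)
open import Data.Fin.Subset using (Subset)
open import Data.Sign using (Sign)
open import Data.Product using (_×_)
open import Function.Bundles using (_⇔_)

open import Level using (_⊔_)
open import Data.Product using (_,_)
open import Data.Fin.Subset using () renaming (_∈_ to _∈ₛ_)
open import Data.Sign using (opposite) renaming (_*_ to _·ₛ_; + to ⊕; - to ⊖)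
open import Data.Sign.Properties using (s*s≡+)
  renaming (*-assoc to ·ₛ-assoc; *-comm to ·ₛ-comm; *-identityʳ to ·ₛ-identityʳ; *-cancelʳ-≡ to ·ₛ-cancelʳ-≡)
open import Data.List using (_++_)
open import Data.List.Membership.Propositional using (_∈_)
open import Function.Bundles using (Equivalence; mk⇔)
import Function.Properties.Equivalence as ⇔
import Relation.Binary.PropositionalEquality as ≡
open ≡ using (_≡_)
import Relation.Binary.Reasoning.Setoid as SetoidReasoning
import Algebra.Properties.AbelianGroup as AbelianGroupProperties
import Algebra.Solver.CommutativeMonoid as CommutativeMonoidSolver

module _ where
  open ≡.≡-Reasoning

  s*t*t≡s : ∀ s t → s ·ₛ t ·ₛ t ≡ s
  s*t*t≡s s t = begin
    s ·ₛ t ·ₛ t    ≡⟨ ·ₛ-assoc s t t ⟩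
    s ·ₛ (t ·ₛ t)  ≡⟨ ≡.cong (s ·ₛ_) (s*s≡+ t) ⟩
    s ·ₛ ⊕         ≡⟨ ·ₛ-identityʳ s ⟩
    s              ∎

  s*t*[t*u]≡s*u : ∀ s t u → s ·ₛ t ·ₛ (t ·ₛ u) ≡ s ·ₛ u
  s*t*[t*u]≡s*u s t u = begin
    s ·ₛ t ·ₛ (t ·ₛ u)  ≡⟨ ·ₛ-assoc (s ·ₛ t) t u ⟨
    s ·ₛ t ·ₛ t ·ₛ u    ≡⟨ ≡.cong (_·ₛ u) (s*t*t≡s s t) ⟩
    s ·ₛ u              ∎

  s*t*u≡u*t*s : ∀ s t u → s ·ₛ t ·ₛ u ≡ u ·ₛ t ·ₛ s
  s*t*u≡u*t*s s t u = begin
    s ·ₛ t ·ₛ u    ≡⟨ ·ₛ-comm (s ·ₛ t) u ⟩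
    u ·ₛ (s ·ₛ t)  ≡⟨ ≡.cong (u ·ₛ_) (·ₛ-comm s t) ⟩
    u ·ₛ (t ·ₛ s)  ≡⟨ ·ₛ-assoc u t s ⟨
    u ·ₛ t ·ₛ s    ∎

  s*[t*s]≡t : ∀ s t → s ·ₛ (t ·ₛ s) ≡ t
  s*[t*s]≡t s t = begin
    s ·ₛ (t ·ₛ s)  ≡⟨ ≡.cong (s ·ₛ_) (·ₛ-comm t s) ⟩
    s ·ₛ (s ·ₛ t)  ≡⟨ ·ₛ-assoc s s t ⟨
    s ·ₛ s ·ₛ t    ≡⟨ ≡.cong (_·ₛ t) (s*s≡+ s) ⟩
    t              ∎

  s*opposite[t]≡opposite[s*t] : ∀ s t → s ·ₛ opposite t ≡ opposite (s ·ₛ t)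
  s*opposite[t]≡opposite[s*t] ⊕ t = ≡.refl
  s*opposite[t]≡opposite[s*t] ⊖ t = ≡.refl

stepArrivalEnd : ∀ {n m} {Γ : Graph n m} {u v} → Step Γ u v → End
stepArrivalEnd (fwd _ _) = ₂
stepArrivalEnd (bwd _ _) = ₁

stepEdge-revStep : ∀ {n m} {Γ : Graph n m} {u v} (t : Step Γ u v) →
                   stepEdge (revStep t) ≡ stepEdge t
stepEdge-revStep (fwd _ _) = ≡.refl
stepEdge-revStep (bwd _ _) = ≡.refl

module _ {c ℓ : Level} (K : Field c ℓ) where
  open Field K
  open AbelianGroupProperties +-abelianGroup
    using (⁻¹-involutive; ε⁻¹≈ε; ⁻¹-∙-comm; ∙-cancelʳ)
  module +-Solver = CommutativeMonoidSolver +-commutativeMonoid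
  open +-Solver using (_⊜_) renaming (_⊕_ to _⊞_)

  infixr 8 _⊙ₖ_
  _⊙ₖ_ : Sign → Carrier → Carrier
  _⊙ₖ_ = _⊙_ K

  ⊙-cong : ∀ s {x y} → x ≈ y → s ⊙ₖ x ≈ s ⊙ₖ y
  ⊙-cong ⊕ x≈y = x≈y
  ⊙-cong ⊖ x≈y = -‿cong x≈y

  ⊙-zeroʳ : ∀ s → s ⊙ₖ 0# ≈ 0#
  ⊙-zeroʳ ⊕ = refl
  ⊙-zeroʳ ⊖ = ε⁻¹≈ε

  ⊙-distribˡ-+ : ∀ s x y → s ⊙ₖ (x + y) ≈ s ⊙ₖ x + s ⊙ₖ y
  ⊙-distribˡ-+ ⊕ x y = refl
  ⊙-distribˡ-+ ⊖ x y = sym (⁻¹-∙-comm x y)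

  ⊙-neg : ∀ s x → s ⊙ₖ (- x) ≈ - (s ⊙ₖ x)
  ⊙-neg ⊕ x = refl
  ⊙-neg ⊖ x = refl

  ⊙-assoc : ∀ s t x → (s ·ₛ t) ⊙ₖ x ≈ s ⊙ₖ t ⊙ₖ x
  ⊙-assoc ⊕ t x = refl
  ⊙-assoc ⊖ ⊕ x = refl
  ⊙-assoc ⊖ ⊖ x = sym (⁻¹-involutive x)

  ⊙-involutive : ∀ s x → s ⊙ₖ s ⊙ₖ x ≈ x
  ⊙-involutive ⊕ x = refl
  ⊙-involutive ⊖ x = ⁻¹-involutive x

  ⊙-opposite : ∀ s x → opposite s ⊙ₖ x ≈ - (s ⊙ₖ x)
  ⊙-opposite ⊕ x = refl
  ⊙-opposite ⊖ x = sym (⁻¹-involutive x)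

  [s*t]⊙t⊙x≈s⊙x : ∀ s t x → (s ·ₛ t) ⊙ₖ t ⊙ₖ x ≈ s ⊙ₖ x
  [s*t]⊙t⊙x≈s⊙x s t x =
    trans (sym (⊙-assoc (s ·ₛ t) t x)) (reflexive (≡.cong (_⊙ₖ x) (s*t*t≡s s t)))

  ⊙-preserves-neutral : ∀ s {x y} → x ≈ s ⊙ₖ y → (y ≈ 0# ⇔ x ≈ 0#)
  ⊙-preserves-neutral s {x} {y} x≈sy = mk⇔
    (λ y≈0 → trans x≈sy (trans (⊙-cong s y≈0) (⊙-zeroʳ s)))
    (λ x≈0 → trans (sym (⊙-involutive s y))
                   (trans (⊙-cong s (trans (sym x≈sy) x≈0)) (⊙-zeroʳ s)))

  x+y≈z+w⇒-x+z≈-w+y : ∀ {x y z w} → x + y ≈ z + w → - x + z ≈ - w + y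
  x+y≈z+w⇒-x+z≈-w+y {x} {y} {z} {w} eq = begin
    - x + z                   ≈⟨ +-identityʳ (- x + z) ⟨
    - x + z + 0#              ≈⟨ +-congˡ (-‿inverseʳ w) ⟨
    - x + z + (w + - w)       ≈⟨ +-Solver.solve 4
                                   (λ x′ z w w′ → ((x′ ⊞ z) ⊞ (w ⊞ w′)) ⊜ ((x′ ⊞ (z ⊞ w)) ⊞ w′))
                                   refl (- x) z w (- w) ⟩
    - x + (z + w) + - w       ≈⟨ +-congʳ (+-congˡ eq) ⟨
    - x + (x + y) + - w       ≈⟨ +-Solver.solve 4
                                   (λ x′ x y w′ → ((x′ ⊞ (x ⊞ y)) ⊞ w′) ⊜ ((x′ ⊞ x) ⊞ (w′ ⊞ y)))
                                   refl (- x) x y (- w) ⟩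
    (- x + x) + (- w + y)     ≈⟨ +-congʳ (-‿inverseˡ x) ⟩
    0# + (- w + y)            ≈⟨ +-identityˡ (- w + y) ⟩
    - w + y                   ∎
    where open SetoidReasoning setoid

  g′+x≈g+y⇒[x+s]+g′+[-y+e]≈s+g+e : ∀ {g′ g x y} s e → g′ + x ≈ g + y →
    (x + s) + g′ + (- y + e) ≈ s + g + e
  g′+x≈g+y⇒[x+s]+g′+[-y+e]≈s+g+e {g′} {g} {x} {y} s e eq = begin
    (x + s) + g′ + (- y + e)      ≈⟨ +-Solver.solve 5
                                       (λ x s g′ y′ e → (((x ⊞ s) ⊞ g′) ⊞ (y′ ⊞ e))
                                                      ⊜ (((s ⊞ (g′ ⊞ x)) ⊞ e) ⊞ y′))
                                       refl x s g′ (- y) e ⟩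
    s + (g′ + x) + e + - y        ≈⟨ +-congʳ (+-congʳ (+-congˡ eq)) ⟩
    s + (g + y) + e + - y         ≈⟨ +-Solver.solve 5
                                       (λ s g y e y′ → (((s ⊞ (g ⊞ y)) ⊞ e) ⊞ y′)
                                                     ⊜ (((s ⊞ g) ⊞ e) ⊞ (y ⊞ y′)))
                                       refl s g y e (- y) ⟩
    s + g + e + (y + - y)         ≈⟨ +-congˡ (-‿inverseʳ y) ⟩
    s + g + e + 0#                ≈⟨ +-identityʳ (s + g + e) ⟩
    s + g + e                     ∎
    where open SetoidReasoning setoid

  module _ {n m : ℕ} (Υ : GSG K n m) where
    open GSG Υ

    signW-++ : ∀ {u v w} (A : Walk Γ u v) (B : Walk Γ v w) →
               signW K Υ (A ++W B) ≡ signW K Υ A ·ₛ signW K Υ B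
    signW-++ []      B = ≡.refl
    signW-++ (t ∷ A) B = ≡.trans (≡.cong (σ (stepEdge t) ·ₛ_) (signW-++ A B))
                                 (≡.sym (·ₛ-assoc (σ (stepEdge t)) (signW K Υ A) (signW K Υ B)))

    signW-revW : ∀ {u v} (W : Walk Γ u v) → signW K Υ (revW W) ≡ signW K Υ W
    signW-revW []      = ≡.refl
    signW-revW (t ∷ W) = begin
      signW K Υ (revW W ++W (revStep t ∷ []))  ≡⟨ signW-++ (revW W) (revStep t ∷ []) ⟩
      signW K Υ (revW W) ·ₛ (σ (stepEdge (revStep t)) ·ₛ ⊕)
        ≡⟨ ≡.cong₂ (λ s e′ → s ·ₛ (σ e′ ·ₛ ⊕)) (signW-revW W) (stepEdge-revStep t) ⟩
      signW K Υ W ·ₛ (σ e ·ₛ ⊕)                 ≡⟨ ≡.cong (signW K Υ W ·ₛ_) (·ₛ-identityʳ (σ e)) ⟩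
      signW K Υ W ·ₛ σ e                        ≡⟨ ·ₛ-comm (signW K Υ W) (σ e) ⟩
      σ e ·ₛ signW K Υ W                        ∎
      where
        open ≡.≡-Reasoning
        e : Fin m
        e = stepEdge t

    signW-handcuffWalk : ∀ {u w} (C₁ : Walk Γ u u) (P : Walk Γ u w) (C₂ : Walk Γ w w) →
      signW K Υ (C₁ ++W P ++W C₂ ++W revW P) ≡ signW K Υ C₁ ·ₛ signW K Υ C₂
    signW-handcuffWalk C₁ P C₂ = begin
      signW K Υ (C₁ ++W P ++W C₂ ++W revW P)
        ≡⟨ signW-++ C₁ _ ⟩
      signW K Υ C₁ ·ₛ signW K Υ (P ++W C₂ ++W revW P)
        ≡⟨ ≡.cong (signW K Υ C₁ ·ₛ_) (signW-++ P _) ⟩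
      signW K Υ C₁ ·ₛ (signW K Υ P ·ₛ signW K Υ (C₂ ++W revW P))
        ≡⟨ ≡.cong (λ s → signW K Υ C₁ ·ₛ (signW K Υ P ·ₛ s)) (signW-++ C₂ (revW P)) ⟩
      signW K Υ C₁ ·ₛ (signW K Υ P ·ₛ (signW K Υ C₂ ·ₛ signW K Υ (revW P)))
        ≡⟨ ≡.cong (λ s → signW K Υ C₁ ·ₛ (signW K Υ P ·ₛ (signW K Υ C₂ ·ₛ s))) (signW-revW P) ⟩
      signW K Υ C₁ ·ₛ (signW K Υ P ·ₛ (signW K Υ C₂ ·ₛ signW K Υ P))
        ≡⟨ ≡.cong (signW K Υ C₁ ·ₛ_) (s*[t*s]≡t (signW K Υ P) (signW K Υ C₂)) ⟩
      signW K Υ C₁ ·ₛ signW K Υ C₂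
        ∎
      where open ≡.≡-Reasoning

    gainAcc-⊙ : ∀ s t {u v} (W : Walk Γ u v) → gainAcc K Υ (s ·ₛ t) W ≈ s ⊙ₖ gainAcc K Υ t W
    gainAcc-⊙ s t []      = sym (⊙-zeroʳ s)
    gainAcc-⊙ s t (t′ ∷ W) = begin
      (s ·ₛ t ·ₛ τ e i) ⊙ₖ φ e + gainAcc K Υ (s ·ₛ t ·ₛ σ e) W
        ≡⟨ ≡.cong₂ (λ a b → a ⊙ₖ φ e + gainAcc K Υ b W) (·ₛ-assoc s t (τ e i)) (·ₛ-assoc s t (σ e)) ⟩
      (s ·ₛ (t ·ₛ τ e i)) ⊙ₖ φ e + gainAcc K Υ (s ·ₛ (t ·ₛ σ e)) W
        ≈⟨ +-cong (⊙-assoc s (t ·ₛ τ e i) (φ e)) (gainAcc-⊙ s (t ·ₛ σ e) W) ⟩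
      s ⊙ₖ (t ·ₛ τ e i) ⊙ₖ φ e + s ⊙ₖ gainAcc K Υ (t ·ₛ σ e) W
        ≈⟨ ⊙-distribˡ-+ s _ _ ⟨
      s ⊙ₖ ((t ·ₛ τ e i) ⊙ₖ φ e + gainAcc K Υ (t ·ₛ σ e) W)     ∎
      where
        open SetoidReasoning setoid
        e : Fin m
        e = stepEdge t′
        i : End
        i = stepEnd t′

    ultrawalkGain : ∀ {u w} → Fin m → Walk Γ u w → Fin m → Carrier
    ultrawalkGain h₁ W h₂ = startHalf K Υ h₁ + gainW K Υ W + endHalf K Υ W h₂

  -- Two gain signed graphs are compared on a common graph Γ; by η for records, Υ on GSG.Γ Υ is Υ.
  _on_ : ∀ {n m} → GSG K n m → Graph n m → GSG K n m
  Υ on Γ = record Υ { Γ = Γ }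

  record NeutralityEquivalent {n m : ℕ} (Γ : Graph n m) (Υ₁ Υ₂ : GSG K n m) : Set (c ⊔ ℓ) where
    field
      closedSign       : ∀ {u} (W : Walk Γ u u) → signW K (Υ₁ on Γ) W ≡ signW K (Υ₂ on Γ) W
      closedNeutral    : ∀ {u} (W : Walk Γ u u) → signW K (Υ₁ on Γ) W ≡ ⊕ →
                         (gainW K (Υ₁ on Γ) W ≈ 0# ⇔ gainW K (Υ₂ on Γ) W ≈ 0#)
      ultrawalkNeutral : ∀ {u w} h₁ → Γ h₁ ≡ half u → ∀ h₂ → Γ h₂ ≡ half w → (W : Walk Γ u w) →
                         (ultrawalkGain (Υ₁ on Γ) h₁ W h₂ ≈ 0# ⇔
                          ultrawalkGain (Υ₂ on Γ) h₁ W h₂ ≈ 0#)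
      looseNeutral     : ∀ e → Γ e ≡ loose → (GSG.φ Υ₁ e ≈ 0# ⇔ GSG.φ Υ₂ e ≈ 0#)

  module _ {n m : ℕ} {Γ : Graph n m} {Υ₁ Υ₂ : GSG K n m} where

    NeutralityEquivalent-sym : NeutralityEquivalent Γ Υ₁ Υ₂ → NeutralityEquivalent Γ Υ₂ Υ₁
    NeutralityEquivalent-sym equivalent = record
      { closedSign       = λ W → ≡.sym (closedSign W)
      ; closedNeutral    = λ W positive → ⇔.sym (closedNeutral W (≡.trans (closedSign W) positive))
      ; ultrawalkNeutral = λ h₁ p₁ h₂ p₂ W → ⇔.sym (ultrawalkNeutral h₁ p₁ h₂ p₂ W)
      ; looseNeutral     = λ e p → ⇔.sym (looseNeutral e p)
      }
      where open NeutralityEquivalent equivalent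

    module _ (equivalent : NeutralityEquivalent Γ Υ₁ Υ₂) where
      open NeutralityEquivalent equivalent

      retagFigure : ∀ {u} → NegFig K (Υ₁ on Γ) u → NegFig K (Υ₂ on Γ) u
      retagFigure (circ C isCircle negative) =
        circ C isCircle (≡.trans (≡.sym (closedSign C)) negative)
      retagFigure (hedge h p) =
        hedge h p

      figEdges-retagFigure : ∀ {u} (F : NegFig K (Υ₁ on Γ) u) →
                             figEdges K (Υ₂ on Γ) (retagFigure F) ≡ figEdges K (Υ₁ on Γ) F
      figEdges-retagFigure (circ _ _ _) = ≡.refl
      figEdges-retagFigure (hedge _ _)  = ≡.refl

      retagHandcuff : ∀ {u w} (F₁ : NegFig K (Υ₁ on Γ) u) (F₂ : NegFig K (Υ₁ on Γ) w)
        {P : Walk Γ u w} → IsHandcuff K (Υ₁ on Γ) F₁ F₂ P →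
        IsHandcuff K (Υ₂ on Γ) (retagFigure F₁) (retagFigure F₂) P
      retagHandcuff (circ _ _ _) (circ _ _ _) isHandcuff = isHandcuff
      retagHandcuff (circ _ _ _) (hedge _ _)  isHandcuff = isHandcuff
      retagHandcuff (hedge _ _)  (circ _ _ _) isHandcuff = isHandcuff
      retagHandcuff (hedge _ _)  (hedge _ _)  isHandcuff = isHandcuff

      retag : SignCircuit K (Υ₁ on Γ) → SignCircuit K (Υ₂ on Γ)
      retag (poscirc C isCircle positive) =
        poscirc C isCircle (≡.trans (≡.sym (closedSign C)) positive)
      retag (looseE e p) =
        looseE e p
      retag (handcuff F₁ F₂ P isHandcuff) =
        handcuff (retagFigure F₁) (retagFigure F₂) P (retagHandcuff F₁ F₂ isHandcuff)

      circuitEdges-retag : ∀ C → circuitEdges K (Υ₂ on Γ) (retag C) ≡ circuitEdges K (Υ₁ on Γ) C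
      circuitEdges-retag (poscirc _ _ _)     = ≡.refl
      circuitEdges-retag (looseE _ _)        = ≡.refl
      circuitEdges-retag (handcuff F₁ F₂ P _) =
        ≡.cong₂ (λ E₁ E₂ → E₁ ++ edgesW P ++ E₂) (figEdges-retagFigure F₁) (figEdges-retagFigure F₂)

      retag-reflects-neutral : ∀ C → circuitGain K (Υ₂ on Γ) (retag C) ≈ 0# →
                               circuitGain K (Υ₁ on Γ) C ≈ 0#
      retag-reflects-neutral (poscirc C _ positive) =
        Equivalence.from (closedNeutral C positive)
      retag-reflects-neutral (looseE e p) =
        Equivalence.from (looseNeutral e p)
      retag-reflects-neutral (handcuff (circ C₁ _ negative₁) (circ C₂ _ negative₂) P _) =
        Equivalence.from (closedNeutral (C₁ ++W P ++W C₂ ++W revW P)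
          (≡.trans (signW-handcuffWalk (Υ₁ on Γ) C₁ P C₂) (≡.cong₂ _·ₛ_ negative₁ negative₂)))
      retag-reflects-neutral (handcuff (hedge h₁ p₁) (circ C₂ _ _) P _) =
        Equivalence.from (ultrawalkNeutral h₁ p₁ h₁ p₁ (P ++W C₂ ++W revW P))
      retag-reflects-neutral (handcuff (circ C₁ _ _) (hedge h₂ p₂) P _) =
        Equivalence.from (ultrawalkNeutral h₂ p₂ h₂ p₂ (revW P ++W C₁ ++W P))
      retag-reflects-neutral (handcuff (hedge h₁ p₁) (hedge h₂ p₂) P _) =
        Equivalence.from (ultrawalkNeutral h₁ p₁ h₂ p₂ P)

      Hyperbalanced-reflect : ∀ S → Hyperbalanced K (Υ₂ on Γ) S → Hyperbalanced K (Υ₁ on Γ) S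
      Hyperbalanced-reflect S balanced C C⊆S =
        retag-reflects-neutral C (balanced (retag C) retag-C⊆S)
        where
          retag-C⊆S : ∀ e → e ∈ circuitEdges K (Υ₂ on Γ) (retag C) → e ∈ₛ S
          retag-C⊆S e e∈ = C⊆S e (≡.subst (e ∈_) (circuitEdges-retag C) e∈)

  Hyperbalanced-⇔ : ∀ {n m} {Γ : Graph n m} {Υ₁ Υ₂ : GSG K n m} → NeutralityEquivalent Γ Υ₁ Υ₂ →
                    ∀ S → Hyperbalanced K (Υ₁ on Γ) S ⇔ Hyperbalanced K (Υ₂ on Γ) S
  Hyperbalanced-⇔ equivalent S =
    mk⇔ (Hyperbalanced-reflect (NeutralityEquivalent-sym equivalent) S)
        (Hyperbalanced-reflect equivalent S)

  -- Sign switching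

  module _ {n m : ℕ} (Υ : GSG K n m) (ζ : Fin n → Sign) where
    open GSG Υ
    private
      Υζ : GSG K n m
      Υζ = signSwitch K Υ ζ

    σ-signSwitch-two : ∀ e {u v} → Γ e ≡ two u v → GSG.σ Υζ e ≡ ζ u ·ₛ σ e ·ₛ ζ v
    σ-signSwitch-two e p with Γ e | p
    ... | .(two _ _) | ≡.refl = ≡.refl

    τ₁-signSwitch-two : ∀ e {u v} → Γ e ≡ two u v → GSG.τ Υζ e ₁ ≡ ζ u ·ₛ τ e ₁
    τ₁-signSwitch-two e p with Γ e | p
    ... | .(two _ _) | ≡.refl = ≡.refl

    τ₂-signSwitch-two : ∀ e {u v} → Γ e ≡ two u v → GSG.τ Υζ e ₂ ≡ ζ v ·ₛ τ e ₂
    τ₂-signSwitch-two e p with Γ e | p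
    ... | .(two _ _) | ≡.refl = ≡.refl

    τ-signSwitch-half : ∀ e {u} → Γ e ≡ half u → GSG.τ Υζ e ₁ ≡ ζ u ·ₛ τ e ₁
    τ-signSwitch-half e p with Γ e | p
    ... | .(half _) | ≡.refl = ≡.refl

    σ-signSwitch-step : ∀ {u v} (t : Step Γ u v) →
                        GSG.σ Υζ (stepEdge t) ≡ ζ u ·ₛ σ (stepEdge t) ·ₛ ζ v
    σ-signSwitch-step         (fwd e p) = σ-signSwitch-two e p
    σ-signSwitch-step {u} {v} (bwd e p) =
      ≡.trans (σ-signSwitch-two e p) (s*t*u≡u*t*s (ζ v) (σ e) (ζ u))

    τ-signSwitch-step : ∀ {u v} (t : Step Γ u v) →
                        GSG.τ Υζ (stepEdge t) (stepEnd t) ≡ ζ u ·ₛ τ (stepEdge t) (stepEnd t)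
    τ-signSwitch-step (fwd e p) = τ₁-signSwitch-two e p
    τ-signSwitch-step (bwd e p) = τ₂-signSwitch-two e p

    signW-signSwitch : ∀ {u v} (W : Walk Γ u v) → signW K Υζ W ·ₛ ζ v ≡ ζ u ·ₛ signW K Υ W
    signW-signSwitch {u} []                 = ≡.sym (·ₛ-identityʳ (ζ u))
    signW-signSwitch {u} {v} (_∷_ {v = x} t W) = begin
      GSG.σ Υζ e ·ₛ signW K Υζ W ·ₛ ζ v        ≡⟨ ·ₛ-assoc (GSG.σ Υζ e) _ (ζ v) ⟩
      GSG.σ Υζ e ·ₛ (signW K Υζ W ·ₛ ζ v)      ≡⟨ ≡.cong₂ _·ₛ_ (σ-signSwitch-step t) (signW-signSwitch W) ⟩
      ζ u ·ₛ σ e ·ₛ ζ x ·ₛ (ζ x ·ₛ signW K Υ W) ≡⟨ s*t*[t*u]≡s*u (ζ u ·ₛ σ e) (ζ x) (signW K Υ W) ⟩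
      ζ u ·ₛ σ e ·ₛ signW K Υ W                ≡⟨ ·ₛ-assoc (ζ u) (σ e) _ ⟩
      ζ u ·ₛ (σ e ·ₛ signW K Υ W)              ∎
      where
        open ≡.≡-Reasoning
        e : Fin m
        e = stepEdge t

    closedSign-signSwitch : ∀ {u} (W : Walk Γ u u) → signW K Υ W ≡ signW K Υζ W
    closedSign-signSwitch {u} W = ≡.sym (·ₛ-cancelʳ-≡ (ζ u) (signW K Υζ W) (signW K Υ W)
      (≡.trans (signW-signSwitch W) (·ₛ-comm (ζ u) (signW K Υ W))))

    -- The ζ-factors of the inner vertices cancel in pairs, so the sums agree term by term.
    gainAcc-signSwitch : ∀ s {u v} (W : Walk Γ u v) → gainAcc K Υζ s W ≡ gainAcc K Υ (s ·ₛ ζ u) W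
    gainAcc-signSwitch s []                     = ≡.refl
    gainAcc-signSwitch s {u} (_∷_ {v = x} t W) =
      ≡.cong₂ _+_ (≡.cong (_⊙ₖ φ e) departure)
                  (≡.trans (gainAcc-signSwitch (s ·ₛ GSG.σ Υζ e) W) (≡.cong (λ r → gainAcc K Υ r W) prefix))
      where
        open ≡.≡-Reasoning
        e : Fin m
        e = stepEdge t
        departure : s ·ₛ GSG.τ Υζ e (stepEnd t) ≡ s ·ₛ ζ u ·ₛ τ e (stepEnd t)
        departure = ≡.trans (≡.cong (s ·ₛ_) (τ-signSwitch-step t)) (≡.sym (·ₛ-assoc s (ζ u) _))
        prefix : s ·ₛ GSG.σ Υζ e ·ₛ ζ x ≡ s ·ₛ ζ u ·ₛ σ e
        prefix = begin
          s ·ₛ GSG.σ Υζ e ·ₛ ζ x              ≡⟨ ≡.cong (λ r → s ·ₛ r ·ₛ ζ x) (σ-signSwitch-step t) ⟩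
          s ·ₛ (ζ u ·ₛ σ e ·ₛ ζ x) ·ₛ ζ x     ≡⟨ ≡.cong (_·ₛ ζ x) (·ₛ-assoc s (ζ u ·ₛ σ e) (ζ x)) ⟨
          s ·ₛ (ζ u ·ₛ σ e) ·ₛ ζ x ·ₛ ζ x     ≡⟨ s*t*t≡s (s ·ₛ (ζ u ·ₛ σ e)) (ζ x) ⟩
          s ·ₛ (ζ u ·ₛ σ e)                   ≡⟨ ·ₛ-assoc s (ζ u) (σ e) ⟨
          s ·ₛ ζ u ·ₛ σ e                     ∎

    gainW-signSwitch : ∀ {u v} (W : Walk Γ u v) → gainW K Υζ W ≈ ζ u ⊙ₖ gainW K Υ W
    gainW-signSwitch {u} W = begin
      - gainAcc K Υζ ⊕ W                 ≡⟨ ≡.cong -_ (gainAcc-signSwitch ⊕ W) ⟩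
      - gainAcc K Υ (ζ u) W              ≡⟨ ≡.cong (λ s → - gainAcc K Υ s W) (·ₛ-identityʳ (ζ u)) ⟨
      - gainAcc K Υ (ζ u ·ₛ ⊕) W         ≈⟨ -‿cong (gainAcc-⊙ Υ (ζ u) ⊕ W) ⟩
      - (ζ u ⊙ₖ gainAcc K Υ ⊕ W)         ≈⟨ ⊙-neg (ζ u) _ ⟨
      ζ u ⊙ₖ gainW K Υ W                 ∎
      where open SetoidReasoning setoid

    ultrawalkGain-signSwitch : ∀ {u w} h₁ → Γ h₁ ≡ half u → ∀ h₂ → Γ h₂ ≡ half w → (W : Walk Γ u w) →
                               ultrawalkGain Υζ h₁ W h₂ ≈ ζ u ⊙ₖ ultrawalkGain Υ h₁ W h₂
    ultrawalkGain-signSwitch {u} {w} h₁ p₁ h₂ p₂ W = begin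
      startHalf K Υζ h₁ + gainW K Υζ W + endHalf K Υζ W h₂
        ≈⟨ +-cong (+-cong departure (gainW-signSwitch W)) arrival ⟩
      ζ u ⊙ₖ startHalf K Υ h₁ + ζ u ⊙ₖ gainW K Υ W + ζ u ⊙ₖ endHalf K Υ W h₂
        ≈⟨ +-congʳ (⊙-distribˡ-+ (ζ u) _ _) ⟨
      ζ u ⊙ₖ (startHalf K Υ h₁ + gainW K Υ W) + ζ u ⊙ₖ endHalf K Υ W h₂
        ≈⟨ ⊙-distribˡ-+ (ζ u) _ _ ⟨
      ζ u ⊙ₖ ultrawalkGain Υ h₁ W h₂
        ∎
      where
        open SetoidReasoning setoid
        departure : startHalf K Υζ h₁ ≈ ζ u ⊙ₖ startHalf K Υ h₁
        departure =
          trans (reflexive (≡.cong (_⊙ₖ φ h₁) (τ-signSwitch-half h₁ p₁))) (⊙-assoc (ζ u) _ _)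
        arrivalSign : signW K Υζ W ·ₛ GSG.τ Υζ h₂ ₁ ≡ ζ u ·ₛ (signW K Υ W ·ₛ τ h₂ ₁)
        arrivalSign = ≡.trans (≡.cong (signW K Υζ W ·ₛ_) (τ-signSwitch-half h₂ p₂))
                 (≡.trans (≡.sym (·ₛ-assoc (signW K Υζ W) (ζ w) (τ h₂ ₁)))
                 (≡.trans (≡.cong (_·ₛ τ h₂ ₁) (signW-signSwitch W)) (·ₛ-assoc (ζ u) _ _)))
        arrival : endHalf K Υζ W h₂ ≈ ζ u ⊙ₖ endHalf K Υ W h₂
        arrival = trans (-‿cong (trans (reflexive (≡.cong (_⊙ₖ φ h₂) arrivalSign)) (⊙-assoc (ζ u) _ _)))
                        (sym (⊙-neg (ζ u) _))

    signSwitch-neutralityEquivalent : NeutralityEquivalent Γ Υ Υζ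
    signSwitch-neutralityEquivalent = record
      { closedSign       = closedSign-signSwitch
      ; closedNeutral    = λ {u} W _ → ⊙-preserves-neutral (ζ u) (gainW-signSwitch W)
      ; ultrawalkNeutral = λ {u} h₁ p₁ h₂ p₂ W →
                             ⊙-preserves-neutral (ζ u) (ultrawalkGain-signSwitch h₁ p₁ h₂ p₂ W)
      ; looseNeutral     = λ _ _ → ⇔.refl
      }

  -- Gain switching

  module _ {n m : ℕ} (Υ : GSG K n m) (wellFormed : IsGSG K Υ) (θ : Fin n → Carrier) where
    open GSG Υ
    private
      Υθ : GSG K n m
      Υθ = gainSwitch K Υ θ

    φ-gainSwitch-two : ∀ e {u v} → Γ e ≡ two u v →
                       GSG.φ Υθ e ≡ τ e ₁ ⊙ₖ θ u + φ e + τ e ₂ ⊙ₖ θ v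
    φ-gainSwitch-two e p with Γ e | p
    ... | .(two _ _) | ≡.refl = ≡.refl

    φ-gainSwitch-half : ∀ e {u} → Γ e ≡ half u → GSG.φ Υθ e ≡ τ e ₁ ⊙ₖ θ u + φ e
    φ-gainSwitch-half e p with Γ e | p
    ... | .(half _) | ≡.refl = ≡.refl

    φ-gainSwitch-loose : ∀ e → Γ e ≡ loose → GSG.φ Υθ e ≡ φ e
    φ-gainSwitch-loose e p with Γ e | p
    ... | .loose | ≡.refl = ≡.refl

    wellFormed-two : ∀ e {u v} → Γ e ≡ two u v → τ e ₁ ·ₛ τ e ₂ ≡ opposite (σ e)
    wellFormed-two e p = ≡.subst (λ ends → WellFormedEdge K Υ ends e) p (wellFormed e)

    τ-departure*τ-arrival : ∀ {u v} (t : Step Γ u v) →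
      τ (stepEdge t) (stepEnd t) ·ₛ τ (stepEdge t) (stepArrivalEnd t) ≡ opposite (σ (stepEdge t))
    τ-departure*τ-arrival (fwd e p) = wellFormed-two e p
    τ-departure*τ-arrival (bwd e p) = ≡.trans (·ₛ-comm (τ e ₂) (τ e ₁)) (wellFormed-two e p)

    φ-gainSwitch-step : ∀ {u v} (t : Step Γ u v) → let e = stepEdge t in
      GSG.φ Υθ e ≈ τ e (stepEnd t) ⊙ₖ θ u + φ e + τ e (stepArrivalEnd t) ⊙ₖ θ v
    φ-gainSwitch-step (fwd e p) = reflexive (φ-gainSwitch-two e p)
    φ-gainSwitch-step {u} {v} (bwd e p) = begin
      GSG.φ Υθ e                                    ≡⟨ φ-gainSwitch-two e p ⟩
      τ e ₁ ⊙ₖ θ v + φ e + τ e ₂ ⊙ₖ θ u             ≈⟨ +-comm _ _ ⟩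
      τ e ₂ ⊙ₖ θ u + (τ e ₁ ⊙ₖ θ v + φ e)           ≈⟨ +-congˡ (+-comm _ _) ⟩
      τ e ₂ ⊙ₖ θ u + (φ e + τ e ₁ ⊙ₖ θ v)           ≈⟨ +-assoc _ _ _ ⟨
      τ e ₂ ⊙ₖ θ u + φ e + τ e ₁ ⊙ₖ θ v             ∎
      where open SetoidReasoning setoid

    stepGain-gainSwitch : ∀ s {u v} (t : Step Γ u v) → let e = stepEdge t ; i = stepEnd t in
      (s ·ₛ τ e i) ⊙ₖ GSG.φ Υθ e + (s ·ₛ σ e) ⊙ₖ θ v ≈ s ⊙ₖ θ u + (s ·ₛ τ e i) ⊙ₖ φ e
    stepGain-gainSwitch s {u} {v} t = begin
      (s ·ₛ τ e i) ⊙ₖ GSG.φ Υθ e + (s ·ₛ σ e) ⊙ₖ θ v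
        ≈⟨ +-congʳ (⊙-cong (s ·ₛ τ e i) (φ-gainSwitch-step t)) ⟩
      (s ·ₛ τ e i) ⊙ₖ (τ e i ⊙ₖ θ u + φ e + τ e j ⊙ₖ θ v) + (s ·ₛ σ e) ⊙ₖ θ v
        ≈⟨ +-congʳ (trans (⊙-distribˡ-+ (s ·ₛ τ e i) _ _) (+-congʳ (⊙-distribˡ-+ (s ·ₛ τ e i) _ _))) ⟩
      (s ·ₛ τ e i) ⊙ₖ τ e i ⊙ₖ θ u + (s ·ₛ τ e i) ⊙ₖ φ e + (s ·ₛ τ e i) ⊙ₖ τ e j ⊙ₖ θ v + (s ·ₛ σ e) ⊙ₖ θ v
        ≈⟨ +-congʳ (+-cong (+-congʳ ([s*t]⊙t⊙x≈s⊙x s (τ e i) (θ u))) opposite-step) ⟩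
      s ⊙ₖ θ u + (s ·ₛ τ e i) ⊙ₖ φ e + - ((s ·ₛ σ e) ⊙ₖ θ v) + (s ·ₛ σ e) ⊙ₖ θ v
        ≈⟨ +-assoc _ _ _ ⟩
      s ⊙ₖ θ u + (s ·ₛ τ e i) ⊙ₖ φ e + (- ((s ·ₛ σ e) ⊙ₖ θ v) + (s ·ₛ σ e) ⊙ₖ θ v)
        ≈⟨ +-congˡ (-‿inverseˡ _) ⟩
      s ⊙ₖ θ u + (s ·ₛ τ e i) ⊙ₖ φ e + 0#
        ≈⟨ +-identityʳ _ ⟩
      s ⊙ₖ θ u + (s ·ₛ τ e i) ⊙ₖ φ e
        ∎
      where
        open SetoidReasoning setoid
        e : Fin m
        e = stepEdge t
        i : End
        i = stepEnd t
        j : End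
        j = stepArrivalEnd t
        opposite-sign : s ·ₛ τ e i ·ₛ τ e j ≡ opposite (s ·ₛ σ e)
        opposite-sign = ≡.trans (·ₛ-assoc s (τ e i) (τ e j))
                       (≡.trans (≡.cong (s ·ₛ_) (τ-departure*τ-arrival t))
                                (s*opposite[t]≡opposite[s*t] s (σ e)))
        opposite-step : (s ·ₛ τ e i) ⊙ₖ τ e j ⊙ₖ θ v ≈ - ((s ·ₛ σ e) ⊙ₖ θ v)
        opposite-step = trans (sym (⊙-assoc (s ·ₛ τ e i) (τ e j) (θ v)))
                       (trans (reflexive (≡.cong (_⊙ₖ θ v) opposite-sign)) (⊙-opposite (s ·ₛ σ e) (θ v)))

    signW-gainSwitch : ∀ {u v} (W : Walk Γ u v) → signW K Υθ W ≡ signW K Υ W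
    signW-gainSwitch []      = ≡.refl
    signW-gainSwitch (t ∷ W) = ≡.cong (σ (stepEdge t) ·ₛ_) (signW-gainSwitch W)

    gainAcc-gainSwitch : ∀ s {u v} (W : Walk Γ u v) →
      gainAcc K Υθ s W + (s ·ₛ signW K Υ W) ⊙ₖ θ v ≈ s ⊙ₖ θ u + gainAcc K Υ s W
    gainAcc-gainSwitch s {u} [] = begin
      0# + (s ·ₛ ⊕) ⊙ₖ θ u    ≈⟨ +-identityˡ _ ⟩
      (s ·ₛ ⊕) ⊙ₖ θ u         ≡⟨ ≡.cong (_⊙ₖ θ u) (·ₛ-identityʳ s) ⟩
      s ⊙ₖ θ u                ≈⟨ +-identityʳ _ ⟨
      s ⊙ₖ θ u + 0#           ∎
      where open SetoidReasoning setoid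
    gainAcc-gainSwitch s {u} {v} (_∷_ {v = x} t W) = begin
      (s ·ₛ τ e i) ⊙ₖ GSG.φ Υθ e + gainAcc K Υθ (s ·ₛ σ e) W + (s ·ₛ (σ e ·ₛ signW K Υ W)) ⊙ₖ θ v
        ≡⟨ ≡.cong (λ r → (s ·ₛ τ e i) ⊙ₖ GSG.φ Υθ e + gainAcc K Υθ (s ·ₛ σ e) W + r ⊙ₖ θ v)
                  (≡.sym (·ₛ-assoc s (σ e) (signW K Υ W))) ⟩
      (s ·ₛ τ e i) ⊙ₖ GSG.φ Υθ e + gainAcc K Υθ (s ·ₛ σ e) W + (s ·ₛ σ e ·ₛ signW K Υ W) ⊙ₖ θ v
        ≈⟨ +-assoc _ _ _ ⟩
      (s ·ₛ τ e i) ⊙ₖ GSG.φ Υθ e + (gainAcc K Υθ (s ·ₛ σ e) W + (s ·ₛ σ e ·ₛ signW K Υ W) ⊙ₖ θ v)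
        ≈⟨ +-congˡ (gainAcc-gainSwitch (s ·ₛ σ e) W) ⟩
      (s ·ₛ τ e i) ⊙ₖ GSG.φ Υθ e + ((s ·ₛ σ e) ⊙ₖ θ x + gainAcc K Υ (s ·ₛ σ e) W)
        ≈⟨ +-assoc _ _ _ ⟨
      (s ·ₛ τ e i) ⊙ₖ GSG.φ Υθ e + (s ·ₛ σ e) ⊙ₖ θ x + gainAcc K Υ (s ·ₛ σ e) W
        ≈⟨ +-congʳ (stepGain-gainSwitch s t) ⟩
      s ⊙ₖ θ u + (s ·ₛ τ e i) ⊙ₖ φ e + gainAcc K Υ (s ·ₛ σ e) W
        ≈⟨ +-assoc _ _ _ ⟩
      s ⊙ₖ θ u + gainAcc K Υ s (t ∷ W)
        ∎
      where
        open SetoidReasoning setoid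
        e : Fin m
        e = stepEdge t
        i : End
        i = stepEnd t

    gainW-gainSwitch : ∀ {u v} (W : Walk Γ u v) →
      gainW K Υθ W + θ u ≈ gainW K Υ W + signW K Υ W ⊙ₖ θ v
    gainW-gainSwitch W = x+y≈z+w⇒-x+z≈-w+y (gainAcc-gainSwitch ⊕ W)

    closedGain-gainSwitch : ∀ {u} (W : Walk Γ u u) → signW K Υ W ≡ ⊕ → gainW K Υθ W ≈ gainW K Υ W
    closedGain-gainSwitch {u} W positive = ∙-cancelʳ (θ u) _ _
      (trans (gainW-gainSwitch W) (+-congˡ (reflexive (≡.cong (_⊙ₖ θ u) positive))))

    ultrawalkGain-gainSwitch : ∀ {u w} h₁ → Γ h₁ ≡ half u → ∀ h₂ → Γ h₂ ≡ half w → (W : Walk Γ u w) →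
                               ultrawalkGain Υθ h₁ W h₂ ≈ ultrawalkGain Υ h₁ W h₂
    ultrawalkGain-gainSwitch {u} {w} h₁ p₁ h₂ p₂ W =
      trans (+-cong (+-congʳ departure) arrival)
            (g′+x≈g+y⇒[x+s]+g′+[-y+e]≈s+g+e (startHalf K Υ h₁) (endHalf K Υ W h₂) (gainW-gainSwitch W))
      where
        open SetoidReasoning setoid
        s : Sign
        s = signW K Υ W
        departure : startHalf K Υθ h₁ ≈ θ u + startHalf K Υ h₁
        departure = begin
          τ h₁ ₁ ⊙ₖ GSG.φ Υθ h₁                         ≡⟨ ≡.cong (τ h₁ ₁ ⊙ₖ_) (φ-gainSwitch-half h₁ p₁) ⟩
          τ h₁ ₁ ⊙ₖ (τ h₁ ₁ ⊙ₖ θ u + φ h₁)              ≈⟨ ⊙-distribˡ-+ (τ h₁ ₁) _ _ ⟩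
          τ h₁ ₁ ⊙ₖ τ h₁ ₁ ⊙ₖ θ u + τ h₁ ₁ ⊙ₖ φ h₁      ≈⟨ +-congʳ (⊙-involutive (τ h₁ ₁) (θ u)) ⟩
          θ u + startHalf K Υ h₁                        ∎
        arrival : endHalf K Υθ W h₂ ≈ - (s ⊙ₖ θ w) + endHalf K Υ W h₂
        arrival = begin
          - ((signW K Υθ W ·ₛ τ h₂ ₁) ⊙ₖ GSG.φ Υθ h₂)
            ≡⟨ ≡.cong₂ (λ r x → - ((r ·ₛ τ h₂ ₁) ⊙ₖ x)) (signW-gainSwitch W) (φ-gainSwitch-half h₂ p₂) ⟩
          - ((s ·ₛ τ h₂ ₁) ⊙ₖ (τ h₂ ₁ ⊙ₖ θ w + φ h₂))
            ≈⟨ -‿cong (⊙-distribˡ-+ (s ·ₛ τ h₂ ₁) _ _) ⟩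
          - ((s ·ₛ τ h₂ ₁) ⊙ₖ τ h₂ ₁ ⊙ₖ θ w + (s ·ₛ τ h₂ ₁) ⊙ₖ φ h₂)
            ≈⟨ -‿cong (+-congʳ ([s*t]⊙t⊙x≈s⊙x s (τ h₂ ₁) (θ w))) ⟩
          - (s ⊙ₖ θ w + (s ·ₛ τ h₂ ₁) ⊙ₖ φ h₂)
            ≈⟨ ⁻¹-∙-comm _ _ ⟨
          - (s ⊙ₖ θ w) + endHalf K Υ W h₂
            ∎

    gainSwitch-neutralityEquivalent : NeutralityEquivalent Γ Υ Υθ
    gainSwitch-neutralityEquivalent = record
      { closedSign       = λ W → ≡.sym (signW-gainSwitch W)
      ; closedNeutral    = λ W positive → ⊙-preserves-neutral ⊕ (closedGain-gainSwitch W positive)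
      ; ultrawalkNeutral = λ h₁ p₁ h₂ p₂ W → ⊙-preserves-neutral ⊕ (ultrawalkGain-gainSwitch h₁ p₁ h₂ p₂ W)
      ; looseNeutral     = λ e p → ⊙-preserves-neutral ⊕ (reflexive (φ-gainSwitch-loose e p))
      }

theorem2p11 : ∀ {c ℓ : Level} (K : Field c ℓ) → CharNot2 K →
    ∀ {n m : ℕ} (Υ : GSG K n m) → IsGSG K Υ →
    (ζ : Fin n → Sign) (θ : Fin n → Field.Carrier K) (S : Subset m) →
    (Hyperbalanced K Υ S ⇔ Hyperbalanced K (signSwitch K Υ ζ) S)
    × (Hyperbalanced K Υ S ⇔ Hyperbalanced K (gainSwitch K Υ θ) S)
-- The characteristic is irrelevant: the argument only adds and negates gains.
theorem2p11 K _ Υ wellFormed ζ θ S =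
    Hyperbalanced-⇔ K (signSwitch-neutralityEquivalent K Υ ζ) S
  , Hyperbalanced-⇔ K (gainSwitch-neutralityEquivalent K Υ wellFormed θ) S
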